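{- Let $G$ be a finite simple graph on $n$ vertices which contains a cycle, and let $g$ be its girth. Then $Z(G) \le n - g + 2$, and this bound is sharp (for instance, equality holds when $G$ is the cycle $C_n$).
   Context: The girth of $G$ is the length of a shortest cycle in $G$. Zero forcing process: start with an initial set $S$ of colored vertices. A colored vertex $v$ forces an uncolored neighbor $w$ (making $w$ colored) if $w$ is the only uncolored neighbor of $v$; forces are applied repeatedly. $S$ is a zero forcing set if eventually every vertex becomes colored. $Z(G)$ is the minimum size of a zero forcing set. -}

module Defs where

open import Data.Nat using (ℕ; zero; suc; _≤_; _%_)
open import Data.Fin using (Fin; zero; suc; toℕ; inject₁; fromℕ)
open import Data.Fin.Subset using (Subset; _∈_; ∣_∣)
open import Data.Bool using (Bool; true; false; _∨_)
open import Data.Product using (Σ; _×_; ∃)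
open import Relation.Binary.PropositionalEquality using (_≡_; _≢_)
open import Relation.Nullary using (¬_)
open import Relation.Nullary.Decidable using (⌊_⌋)
open import Function.Definitions using (Injective)
open import Data.Nat.DivMod using (n%n≡0; m<n⇒m%n≡m)
open import Data.Nat.Properties using (m≤n⇒m<n∨m≡n)
open import Data.Fin.Properties using (toℕ<n)
open import Data.Bool.Properties using (∨-comm)
import Data.Empty
open import Data.Sum using (inj₁; inj₂)
open import Relation.Nullary using (yes; no)
import Relation.Binary.PropositionalEquality as Eq
open Eq using (refl)

record Graph (n : ℕ) : Set where
  field
    adj    : Fin n → Fin n → Bool
    sym    : ∀ i j → adj i j ≡ adj j i
    irrefl : ∀ i → adj i i ≡ false
open Graph public

Adj : ∀ {n} → Graph n → Fin n → Fin n → Set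
Adj G i j = adj G i j ≡ true

record Cycle {n : ℕ} (G : Graph n) : Set where
  field
    m        : ℕ
    long     : 3 ≤ suc m
    vs       : Fin (suc m) → Fin n
    distinct : Injective _≡_ _≡_ vs
    step     : ∀ (i : Fin m) → Adj G (vs (inject₁ i)) (vs (suc i))
    close    : Adj G (vs (fromℕ m)) (vs zero)
open Cycle public

cycleLength : ∀ {n} {G : Graph n} → Cycle G → ℕ
cycleLength C = suc (m C)

IsGirth : ∀ {n} → Graph n → ℕ → Set
IsGirth G g = (Σ (Cycle G) λ C → cycleLength C ≡ g)
            × (∀ (C : Cycle G) → g ≤ cycleLength C)

-- Vertices that eventually become coloured in the zero forcing process
-- started from S: either initially coloured, or forced by a coloured
-- neighbour u all of whose other neighbours are coloured.
data Colored {n : ℕ} (G : Graph n) (S : Subset n) : Fin n → Set where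
  initial : ∀ {v} → v ∈ S → Colored G S v
  force   : ∀ {u v} → Colored G S u → Adj G u v →
            (∀ w → Adj G u w → w ≢ v → Colored G S w) →
            Colored G S v

IsZeroForcingSet : ∀ {n} → Graph n → Subset n → Set
IsZeroForcingSet G S = ∀ v → Colored G S v

IsZeroForcingNumber : ∀ {n} → Graph n → ℕ → Set
IsZeroForcingNumber {n} G z =
  (Σ (Subset n) λ S → IsZeroForcingSet G S × ∣ S ∣ ≡ z)
  × (∀ (S : Subset n) → IsZeroForcingSet G S → z ≤ ∣ S ∣)

cycAdj : (n : ℕ) → .{{_ : Data.Nat.NonZero n}} → Fin n → Fin n → Bool
cycAdj n i j = ⌊ suc (toℕ i) % n Data.Nat.≟ toℕ j ⌋ ∨ ⌊ suc (toℕ j) % n Data.Nat.≟ toℕ i ⌋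

private
  sn≢n : (x : ℕ) → suc x ≢ x
  sn≢n zero ()
  sn≢n (suc x) e = sn≢n x (Eq.cong Data.Nat.pred e)

  suc%≢ : (k : ℕ) (i : Fin (suc (suc (suc k)))) →
          suc (toℕ i) % suc (suc (suc k)) ≢ toℕ i
  suc%≢ k i eq with m≤n⇒m<n∨m≡n (toℕ<n i)
  ... | inj₁ lt = sn≢n (toℕ i) (Eq.trans (Eq.sym (m<n⇒m%n≡m lt)) eq)
  ... | inj₂ e with Eq.trans (Eq.trans (Eq.sym (n%n≡0 (suc (suc (suc k)))))
                     (Eq.trans (Eq.cong (_% suc (suc (suc k))) (Eq.sym e)) eq))
                     (Eq.cong Data.Nat.pred e)
  ... | ()

  cycIrrefl : (k : ℕ) (i : Fin (suc (suc (suc k)))) → cycAdj (suc (suc (suc k))) i i ≡ false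
  cycIrrefl k i with suc (toℕ i) % suc (suc (suc k)) Data.Nat.≟ toℕ i
  ... | yes p = Data.Empty.⊥-elim (suc%≢ k i p)
  ... | no _ = refl

-- The cycle graph C_{k+3} (every cycle graph has at least 3 vertices).
CycleGraph : (k : ℕ) → Graph (suc (suc (suc k)))
CycleGraph k = record
  { adj    = cycAdj (suc (suc (suc k)))
  ; sym    = λ i j → ∨-comm (⌊ suc (toℕ i) % suc (suc (suc k)) Data.Nat.≟ toℕ j ⌋) (⌊ suc (toℕ j) % suc (suc (suc k)) Data.Nat.≟ toℕ i ⌋)
  ; irrefl = cycIrrefl k
  }

module Submission where

-- Let v₀ v₁ … v_M be a shortest cycle (g = M + 1) and let S be the
-- complement of its tail {v₂, …, v_M}.  A shortest cycle has no chord, so once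
-- v₀ … v_{t+1} are coloured, every neighbour of v_{t+1} other than v_{t+2} is
-- already coloured (it is outside the tail, or some v_j with j ≤ t + 1), and
-- v_{t+1} forces v_{t+2}.  Hence S is a zero forcing set of size n − (M − 1).
--
-- In C_N the only neighbours of u are its successor and predecessor.
-- A cycle gives every one of its vertices two distinct neighbours on the cycle,
-- so the vertex set of any cycle of C_N is closed under both, hence is everything:
-- the girth is N.  A graph in which every vertex has two distinct neighbours
-- admits no forcing from a set of at most one vertex, so Z(C_N) ≥ 2 = N − N + 2.

open import Defs hiding (sym)
open import Data.Nat using (ℕ; zero; suc; _+_; _∸_; _%_; _≤_; _<_; _≤?_; z≤n; s≤s; s≤s⁻¹) renaming (_≟_ to _≟ℕ_)
open import Data.Nat.Properties
  using ( ≤-trans; ≤-refl; ≤-reflexive; ≤-antisym; <-irrefl; <⇒≱; <-cmp; n≤1+n; m≤n⇒m<n∨m≡n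
        ; +-comm; +-monoʳ-≤; +-monoˡ-≤; +-suc; +-identityʳ; +-cancelˡ-≡; suc-injective
        ; ∸-monoʳ-≤; m+[n∸m]≡n; m+n≤o⇒m≤o∸n; n∸n≡0; module ≤-Reasoning )
open import Data.Nat.DivMod using (m%n<n; m<n⇒m%n≡m; n%n≡0)
open import Data.Fin using (Fin; zero; suc; toℕ; inject₁; fromℕ; fromℕ<)
open import Data.Fin.Properties
  using (toℕ-injective; toℕ-fromℕ<; fromℕ<-toℕ; toℕ<n; toℕ-inject₁; toℕ-fromℕ; any?; injective⇒≤; _≟_)
  renaming (suc-injective to Fin-suc-injective)
open import Data.Fin.Subset using (Subset; _∈_; _∉_; ∣_∣; ∁; _-_)
open import Data.Fin.Subset.Properties using (x∈p∧x≢y⇒x∈p-y; x∈p⇒∣p-x∣<∣p∣; ∣∁p∣≡n∸∣p∣; x∉p⇒x∈∁p)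
open import Data.Vec using (tabulate)
open import Data.Vec.Properties using (lookup∘tabulate; lookup⇒[]=; []=⇒lookup)
open import Data.Bool using (true; _∨_)
open import Data.Product using (Σ; _×_; ∃; ∃₂; _,_; proj₁; proj₂)
open import Data.Sum using (_⊎_; inj₁; inj₂)
open import Data.Empty using (⊥-elim)
open import Function using (_∘_)
open import Function.Definitions using (Injective)
open import Relation.Nullary using (¬_; Dec; does; yes; no)
open import Relation.Nullary.Decidable using (⌊_⌋; dec-true; dec-false; _×-dec_)
open import Relation.Unary using (Decidable)
open import Relation.Binary.Definitions using (tri<; tri≈; tri>)
open import Relation.Binary.PropositionalEquality using (_≡_; _≢_; refl; sym; trans; cong; subst; subst₂; module ≡-Reasoning)

adj-sym : ∀ {n} (G : Graph n) {i j} → Adj G i j → Adj G j i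
adj-sym G {i} {j} i~j = trans (Graph.sym G j i) i~j

injection⇒≤∣∣ : ∀ {n k} (p : Subset n) (f : Fin k → Fin n) →
                Injective _≡_ _≡_ f → (∀ a → f a ∈ p) → k ≤ ∣ p ∣
injection⇒≤∣∣ {k = zero}  p f f-inj f∈p = z≤n
injection⇒≤∣∣ {k = suc k} p f f-inj f∈p =
  ≤-trans (s≤s (injection⇒≤∣∣ (p - f zero) (f ∘ suc) (λ e → Fin-suc-injective (f-inj e))
                 (λ a → x∈p∧x≢y⇒x∈p-y (f∈p (suc a)) (suc≢zero ∘ f-inj))))
          (x∈p⇒∣p-x∣<∣p∣ (f∈p zero))
  where
    suc≢zero : ∀ {a : Fin k} → suc a ≢ zero
    suc≢zero ()

two-members : ∀ {n} {p : Subset n} {x y} → x ∈ p → y ∈ p → x ≢ y → 2 ≤ ∣ p ∣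
two-members x∈p y∈p x≢y =
  ≤-trans (s≤s (≤-trans (s≤s z≤n) (x∈p⇒∣p-x∣<∣p∣ (x∈p∧x≢y⇒x∈p-y y∈p (x≢y ∘ sym)))))
          (x∈p⇒∣p-x∣<∣p∣ x∈p)

subsetOf : ∀ {n} {P : Fin n → Set} → Decidable P → Subset n
subsetOf P? = tabulate (λ x → does (P? x))

∈-subsetOf : ∀ {n} {P : Fin n → Set} (P? : Decidable P) {x} → P x → x ∈ subsetOf P?
∈-subsetOf P? {x} px = lookup⇒[]= x _ (trans (lookup∘tabulate _ x) (dec-true (P? x) px))

∉-subsetOf : ∀ {n} {P : Fin n → Set} (P? : Decidable P) {x} → ¬ P x → x ∉ subsetOf P?
∉-subsetOf P? {x} ¬px x∈ with trans (sym (dec-false (P? x) ¬px))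
                                    (trans (sym (lookup∘tabulate _ x)) ([]=⇒lookup x∈))
... | ()

TwoNeighboursIn : ∀ {n} → Graph n → (Fin n → Set) → Fin n → Set
TwoNeighboursIn G P u = ∃₂ λ x y → x ≢ y × (Adj G u x × P x) × (Adj G u y × P y)

MinDegreeTwo : ∀ {n} → Graph n → Set
MinDegreeTwo G = ∀ u → ∃₂ λ x y → x ≢ y × Adj G u x × Adj G u y

module CycleWalk {n} {G : Graph n} (C : Cycle G) where

  M : ℕ
  M = m C

  2≤M : 2 ≤ M
  2≤M = s≤s⁻¹ (long C)

  -- Positions beyond M are never used; they are sent to v₀.
  V : ℕ → Fin n
  V t with t ≤? M
  ... | yes t≤M = vs C (fromℕ< (s≤s t≤M))
  ... | no _    = vs C zero

  V-at : ∀ {t} (t≤M : t ≤ M) → V t ≡ vs C (fromℕ< (s≤s t≤M))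
  V-at {t} t≤M with t ≤? M
  ... | yes _   = refl
  ... | no t≰M  = ⊥-elim (t≰M t≤M)

  position≤M : (a : Fin (suc M)) → toℕ a ≤ M
  position≤M a = s≤s⁻¹ (toℕ<n a)

  V-vs : (a : Fin (suc M)) → V (toℕ a) ≡ vs C a
  V-vs a = trans (V-at (position≤M a)) (cong (vs C) (fromℕ<-toℕ a _))

  V-inj : ∀ {t u} → t ≤ M → u ≤ M → V t ≡ V u → t ≡ u
  V-inj {t} {u} t≤M u≤M e =
    trans (sym (toℕ-fromℕ< (s≤s t≤M)))
      (trans (cong toℕ (distinct C (trans (sym (V-at t≤M)) (trans e (V-at u≤M)))))
             (toℕ-fromℕ< (s≤s u≤M)))

  V-step : ∀ t → t < M → Adj G (V t) (V (suc t))
  V-step t t<M = subst₂ (Adj G)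
    (trans (sym (V-vs (inject₁ a))) (cong V (trans (toℕ-inject₁ a) (toℕ-fromℕ< t<M))))
    (trans (sym (V-vs (suc a))) (cong (V ∘ suc) (toℕ-fromℕ< t<M)))
    (step C a)
    where
      a : Fin M
      a = fromℕ< t<M

  V-close : Adj G (V M) (V 0)
  V-close = subst₂ (Adj G) (trans (sym (V-vs (fromℕ M))) (cong V (toℕ-fromℕ M))) (sym (V-vs zero)) (close C)

  -- A chord v_i v_{i+d} with d ≥ 2 closes the cycle v_i v_{i+1} … v_{i+d} of length d + 1.
  shortcut : ∀ i d → 2 ≤ d → i + d ≤ M → Adj G (V i) (V (i + d)) →
             Σ (Cycle G) λ C' → cycleLength C' ≡ suc d
  shortcut i d 2≤d i+d≤M chord = C' , refl
    where
      in-range : ∀ (k : Fin (suc d)) → i + toℕ k ≤ M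
      in-range k = ≤-trans (+-monoʳ-≤ i (s≤s⁻¹ (toℕ<n k))) i+d≤M
      C' : Cycle G
      C' = record
        { m        = d
        ; long     = s≤s 2≤d
        ; vs       = λ k → V (i + toℕ k)
        ; distinct = λ {a} {b} e → toℕ-injective (+-cancelˡ-≡ i _ _ (V-inj (in-range a) (in-range b) e))
        ; step     = λ k → subst₂ (λ x y → Adj G (V x) (V y))
                       (cong (i +_) (sym (toℕ-inject₁ k))) (sym (+-suc i (toℕ k)))
                       (V-step (i + toℕ k) (≤-trans (≤-reflexive (sym (+-suc i (toℕ k))))
                                                    (≤-trans (+-monoʳ-≤ i (toℕ<n k)) i+d≤M)))
        ; close    = subst₂ (λ x y → Adj G (V x) (V y))
                       (cong (i +_) (sym (toℕ-fromℕ d))) (sym (+-identityʳ i))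
                       (adj-sym G chord)
        }

  OnCycle : Fin n → Set
  OnCycle x = ∃ λ a → vs C a ≡ x

  -- Position t has two distinct neighbouring positions: t ± 1, read cyclically.
  neighbourPositions : ∀ t → t ≤ M →
    ∃₂ λ s r → s ≤ M × r ≤ M × s ≢ r × Adj G (V t) (V s) × Adj G (V t) (V r)
  neighbourPositions zero _ =
    1 , M , ≤-trans (s≤s z≤n) 2≤M , ≤-refl , (λ e → <-irrefl refl (≤-trans 2≤M (≤-reflexive (sym e)))) ,
    V-step 0 (≤-trans (s≤s z≤n) 2≤M) , adj-sym G V-close
  neighbourPositions (suc s) s<M with m≤n⇒m<n∨m≡n s<M
  ... | inj₁ s+1<M = s , suc (suc s) , ≤-trans (n≤1+n s) s<M , s+1<M , s≢s+2 s ,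
                     adj-sym G (V-step s s<M) , V-step (suc s) s+1<M
    where
      s≢s+2 : ∀ s → s ≢ suc (suc s)
      s≢s+2 zero    ()
      s≢s+2 (suc s) e = s≢s+2 s (suc-injective e)
  ... | inj₂ s+1≡M = s , 0 , ≤-trans (n≤1+n s) s<M , z≤n , s≢0 ,
                     adj-sym G (V-step s s<M) , subst (λ x → Adj G (V x) (V 0)) (sym s+1≡M) V-close
    where
      s≢0 : s ≢ 0
      s≢0 refl = <-irrefl refl (≤-trans 2≤M (≤-reflexive (sym s+1≡M)))

  twoNeighbours : ∀ {u} → OnCycle u → TwoNeighboursIn G OnCycle u
  twoNeighbours (a , refl) with neighbourPositions (toℕ a) (position≤M a)
  ... | s , r , s≤M , r≤M , s≢r , t~s , t~r =
    V s , V r , s≢r ∘ V-inj s≤M r≤M ,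
    (on-path t~s , (fromℕ< (s≤s s≤M) , sym (V-at s≤M))) ,
    (on-path t~r , (fromℕ< (s≤s r≤M) , sym (V-at r≤M)))
    where
      on-path : ∀ {x} → Adj G (V (toℕ a)) x → Adj G (vs C a) x
      on-path = subst (λ y → Adj G y _) (V-vs a)

∸-shift : ∀ n M → 2 ≤ M → suc M ≤ n → n ∸ (M ∸ 1) ≡ n ∸ suc M + 2
∸-shift (suc (suc (suc n))) (suc (suc zero))    _ _       = sym (+-comm n 2)
∸-shift (suc n)             (suc (suc (suc M))) _ (s≤s p) = ∸-shift n (suc (suc M)) (s≤s (s≤s z≤n)) p
∸-shift _                   (suc zero)          (s≤s ()) _
∸-shift (suc (suc zero))    (suc (suc zero))    _ (s≤s (s≤s ()))

module ShortestCycle {n} {G : Graph n} (C : Cycle G)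
                     (shortest : ∀ (C' : Cycle G) → cycleLength C ≤ cycleLength C') where
  open CycleWalk C

  no-chord : ∀ i j → 1 ≤ i → 2 + i ≤ j → j ≤ M → ¬ Adj G (V i) (V j)
  no-chord i j 1≤i i+2≤j j≤M chord = <-irrefl refl (≤-trans shorter (shortest C'))
    where
      i+d≡j : i + (j ∸ i) ≡ j
      i+d≡j = m+[n∸m]≡n (≤-trans (n≤1+n i) (≤-trans (n≤1+n (suc i)) i+2≤j))
      C'+len : Σ (Cycle G) λ C' → cycleLength C' ≡ suc (j ∸ i)
      C'+len = shortcut i (j ∸ i) (m+n≤o⇒m≤o∸n 2 i+2≤j) (≤-trans (≤-reflexive i+d≡j) j≤M)
                        (subst (Adj G (V i) ∘ V) (sym i+d≡j) chord)
      C' : Cycle G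
      C' = proj₁ C'+len
      shorter : cycleLength C' < suc M
      shorter = s≤s (≤-trans (≤-reflexive (proj₂ C'+len))
                       (≤-trans (+-monoˡ-≤ (j ∸ i) 1≤i) (≤-trans (≤-reflexive i+d≡j) j≤M)))

  InTail : Fin n → Set
  InTail w = ∃ λ (a : Fin (suc M)) → 2 ≤ toℕ a × vs C a ≡ w

  inTail? : Decidable InTail
  inTail? w = any? (λ a → (2 ≤? toℕ a) ×-dec (vs C a ≟ w))

  Tail : Subset n
  Tail = subsetOf inTail?

  S : Subset n
  S = ∁ Tail

  outsideTail : ∀ {w} → ¬ InTail w → w ∈ S
  outsideTail = x∉p⇒x∈∁p ∘ ∉-subsetOf inTail?

  head-in-S : ∀ j → j < 2 → j ≤ M → V j ∈ S
  head-in-S j j<2 j≤M = outsideTail λ (a , 2≤a , e) →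
    <⇒≱ j<2 (subst (2 ≤_) (V-inj (position≤M a) j≤M (trans (V-vs a) e)) 2≤a)

  Prefix : ℕ → Set
  Prefix t = ∀ j → j ≤ t → j ≤ M → Colored G S (V j)

  -- Once v₀ … v_{t+1} are coloured, v_{t+1} forces v_{t+2}: any other neighbour w
  -- is outside the tail, is an earlier cycle vertex, or would be a chord.

  forceNext : ∀ t → suc (suc t) ≤ M → Prefix (suc t) → Colored G S (V (suc (suc t)))
  forceNext t t+2≤M prefix =
    force (prefix (suc t) ≤-refl (≤-trans (n≤1+n _) t+2≤M)) (V-step (suc t) t+2≤M) others
    where
      others : ∀ w → Adj G (V (suc t)) w → w ≢ V (suc (suc t)) → Colored G S w
      others w _ _ with inTail? w
      others w _ _ | no ¬tail = initial (outsideTail ¬tail)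
      others _ t+1~w w≢next | yes (a , _ , refl) with <-cmp (toℕ a) (suc (suc t))
      ... | tri< a<t+2 _ _ = subst (Colored G S) (V-vs a) (prefix (toℕ a) (s≤s⁻¹ a<t+2) (position≤M a))
      ... | tri≈ _ a≡t+2 _ = ⊥-elim (w≢next (trans (sym (V-vs a)) (cong V a≡t+2)))
      ... | tri> _ _ a>t+2 = ⊥-elim (no-chord (suc t) (toℕ a) (s≤s z≤n) a>t+2 (position≤M a)
                                       (subst (Adj G (V (suc t))) (sym (V-vs a)) t+1~w))

  extend : ∀ t → Prefix (suc t) → Prefix (suc (suc t))
  extend t prefix j j≤t+2 j≤M with m≤n⇒m<n∨m≡n j≤t+2
  ... | inj₁ j<t+2 = prefix j (s≤s⁻¹ j<t+2) j≤M
  ... | inj₂ refl  = forceNext t j≤M prefix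

  prefix : ∀ t → Prefix t
  prefix zero          j j≤0 j≤M = initial (head-in-S j (≤-trans (s≤s j≤0) (n≤1+n 1)) j≤M)
  prefix (suc zero)    j j≤1 j≤M = initial (head-in-S j (s≤s j≤1) j≤M)
  prefix (suc (suc t)) = extend t (prefix (suc t))

  zeroForcing : IsZeroForcingSet G S
  zeroForcing w with inTail? w
  ... | no ¬tail          = initial (outsideTail ¬tail)
  ... | yes (a , _ , refl) = subst (Colored G S) (V-vs a) (prefix (toℕ a) (toℕ a) ≤-refl (position≤M a))

  -- The tail has at least M − 1 vertices: a ↦ v_{a+2} injects into it.
  tailSize : M ∸ 1 ≤ ∣ Tail ∣
  tailSize = injection⇒≤∣∣ Tail f f-inj
               (λ a → ∈-subsetOf inTail? (_ , ≤-trans (s≤s (s≤s z≤n)) (≤-reflexive (sym (toℕ-fromℕ< (shift a)))) , refl))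
    where
      shift : ∀ (a : Fin (M ∸ 1)) → suc (suc (toℕ a)) < suc M
      shift a = lift M (toℕ<n a)
        where
          lift : ∀ K {x} → x < K ∸ 1 → suc (suc x) < suc K
          lift (suc K) x<K = s≤s (s≤s x<K)
      f : Fin (M ∸ 1) → Fin n
      f a = vs C (fromℕ< (shift a))
      f-inj : Injective _≡_ _≡_ f
      f-inj {a} {b} e = toℕ-injective (suc-injective (suc-injective
        (trans (sym (toℕ-fromℕ< (shift a))) (trans (cong toℕ (distinct C e)) (toℕ-fromℕ< (shift b))))))

  S-size : ∣ S ∣ ≤ n ∸ cycleLength C + 2
  S-size = begin
    ∣ S ∣            ≡⟨ ∣∁p∣≡n∸∣p∣ Tail ⟩
    n ∸ ∣ Tail ∣     ≤⟨ ∸-monoʳ-≤ n tailSize ⟩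
    n ∸ (M ∸ 1)      ≡⟨ ∸-shift n M 2≤M (injective⇒≤ (distinct C)) ⟩
    n ∸ suc M + 2    ∎
    where open ≤-Reasoning

zeroForcing≤ : (n : ℕ) (G : Graph n) (g z : ℕ) →
               IsGirth G g → IsZeroForcingNumber G z → z ≤ n ∸ g + 2
zeroForcing≤ n G g z ((C , refl) , shortest) (_ , minimal) = ≤-trans (minimal S zeroForcing) S-size
  where open ShortestCycle C shortest

∨-split : ∀ {P Q : Set} (p? : Dec P) (q? : Dec Q) → ⌊ p? ⌋ ∨ ⌊ q? ⌋ ≡ true → P ⊎ Q
∨-split (yes p) _       _  = inj₁ p
∨-split (no _)  (yes q) _  = inj₂ q
∨-split (no _)  (no _)  ()

no-loop : ∀ {n} (G : Graph n) {u} → ¬ Adj G u u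
no-loop G {u} u~u with trans (sym u~u) (irrefl G u)
... | ()

-- In a graph of minimum degree two a set with at most one vertex forces nothing:
-- a forcing vertex u needs a second coloured neighbour, which would have to be u.
stalls : ∀ {n} {G : Graph n} {S : Subset n} → MinDegreeTwo G →
         (∀ {x y} → x ∈ S → y ∈ S → x ≡ y) → ∀ {v} → Colored G S v → v ∈ S
stalls δ sub (initial v∈S) = v∈S
stalls {n} {G} {S} δ sub (force {u} {v} u-col _ others) =
  ⊥-elim (no-loop G (subst (Adj G u) (sub w∈S (stalls δ sub u-col)) u~w))
  where
    another : ∃ λ w → Adj G u w × w ≢ v
    another with δ u
    ... | x , y , x≢y , u~x , u~y with x ≟ v
    ...   | yes x≡v = y , u~y , λ y≡v → x≢y (trans x≡v (sym y≡v))
    ...   | no x≢v  = x , u~x , x≢v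
    w : Fin n
    w = proj₁ another
    u~w : Adj G u w
    u~w = proj₁ (proj₂ another)
    w∈S : w ∈ S
    w∈S = stalls δ sub (others w u~w (proj₂ (proj₂ another)))

2≤zeroForcingSet : ∀ {n} {G : Graph n} {S : Subset n} → MinDegreeTwo G →
                   (a b : Fin n) → a ≢ b → IsZeroForcingSet G S → 2 ≤ ∣ S ∣
2≤zeroForcingSet {S = S} δ a b a≢b zf with 2 ≤? ∣ S ∣
... | yes 2≤∣S∣ = 2≤∣S∣
... | no 2≰∣S∣  = ⊥-elim (2≰∣S∣ (two-members (stalls δ subsingleton (zf a)) (stalls δ subsingleton (zf b)) a≢b))
  where
    subsingleton : ∀ {x y} → x ∈ S → y ∈ S → x ≡ y
    subsingleton {x} {y} x∈S y∈S with x ≟ y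
    ... | yes x≡y = x≡y
    ... | no x≢y  = ⊥-elim (2≰∣S∣ (two-members x∈S y∈S x≢y))

module CycleGraphFacts (k : ℕ) where

  N : ℕ
  N = suc (suc (suc k))

  G : Graph N
  G = CycleGraph k

  next : Fin N → Fin N
  next u = fromℕ< (m%n<n (suc (toℕ u)) N)

  prev : Fin N → Fin N
  prev zero    = fromℕ (suc (suc k))
  prev (suc u) = inject₁ u

  wrap : (i : Fin N) → (suc (toℕ i) % N ≡ suc (toℕ i)) ⊎ (toℕ i ≡ suc (suc k) × suc (toℕ i) % N ≡ 0)
  wrap i with m≤n⇒m<n∨m≡n (toℕ<n i)
  ... | inj₁ i+1<N = inj₁ (m<n⇒m%n≡m i+1<N)
  ... | inj₂ i+1≡N = inj₂ (suc-injective i+1≡N , trans (cong (_% N) i+1≡N) (n%n≡0 N))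

  next-inject₁ : (y : Fin (suc (suc k))) → next (inject₁ y) ≡ suc y
  next-inject₁ y = toℕ-injective (begin
    toℕ (next (inject₁ y))         ≡⟨ toℕ-fromℕ< _ ⟩
    suc (toℕ (inject₁ y)) % N      ≡⟨ cong (λ x → suc x % N) (toℕ-inject₁ y) ⟩
    suc (toℕ y) % N                ≡⟨ m<n⇒m%n≡m (toℕ<n (suc y)) ⟩
    suc (toℕ y)                    ∎)
    where open ≡-Reasoning

  predecessor : ∀ x u → suc (toℕ x) % N ≡ toℕ u → x ≡ prev u
  predecessor x zero    e with wrap x
  ... | inj₁ r          with trans (sym r) e
  ...   | ()
  predecessor x zero    e | inj₂ (x≡last , _) = toℕ-injective (trans x≡last (sym (toℕ-fromℕ _)))
  predecessor x (suc u) e with wrap x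
  ... | inj₁ r = toℕ-injective (trans (suc-injective (trans (sym r) e)) (sym (toℕ-inject₁ u)))
  ... | inj₂ (_ , r)    with trans (sym r) e
  ...   | ()

  neighbours : ∀ {u x} → Adj G u x → x ≡ next u ⊎ x ≡ prev u
  neighbours {u} {x} u~x with ∨-split (suc (toℕ u) % N ≟ℕ toℕ x) (suc (toℕ x) % N ≟ℕ toℕ u) u~x
  ... | inj₁ u+1≡x = inj₁ (toℕ-injective (trans (sym u+1≡x) (sym (toℕ-fromℕ< _))))
  ... | inj₂ x+1≡u = inj₂ (predecessor x u x+1≡u)

  module Spanning (C : Cycle G) where
    open CycleWalk C

    -- next u and prev u are the two distinct cycle neighbours of a cycle vertex u.
    closed : ∀ {u} → OnCycle u → OnCycle (next u) × OnCycle (prev u)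
    closed {u} u∈C with twoNeighbours u∈C
    ... | x , y , x≢y , (u~x , x∈C) , (u~y , y∈C) with neighbours {u} u~x | neighbours {u} u~y
    ... | inj₁ refl | inj₁ refl = ⊥-elim (x≢y refl)
    ... | inj₁ refl | inj₂ refl = x∈C , y∈C
    ... | inj₂ refl | inj₁ refl = y∈C , x∈C
    ... | inj₂ refl | inj₂ refl = ⊥-elim (x≢y refl)

    reach-zero : ∀ j (x : Fin N) → toℕ x ≡ j → OnCycle x → OnCycle zero
    reach-zero zero    zero    _ x∈C = x∈C
    reach-zero (suc j) (suc x) e x∈C =
      reach-zero j (inject₁ x) (trans (toℕ-inject₁ x) (suc-injective e)) (proj₂ (closed x∈C))
    reach-zero zero    (suc _) ()
    reach-zero (suc _) zero    ()

    reach-all : OnCycle zero → ∀ j (y : Fin N) → toℕ y ≡ j → OnCycle y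
    reach-all 0∈C zero    zero    _ = 0∈C
    reach-all 0∈C (suc j) (suc y) e = subst OnCycle (next-inject₁ y)
      (proj₁ (closed (reach-all 0∈C j (inject₁ y) (trans (toℕ-inject₁ y) (suc-injective e)))))
    reach-all 0∈C zero    (suc _) ()
    reach-all 0∈C (suc _) zero    ()

    spanning : ∀ x → OnCycle x
    spanning x = reach-all (reach-zero _ (vs C zero) refl (zero , refl)) _ x refl

    -- Choosing a position for every vertex is injective, so the cycle has length N.
    length≡N : cycleLength C ≡ N
    length≡N = ≤-antisym (injective⇒≤ (distinct C)) (injective⇒≤ position-inj)
      where
        position-inj : Injective _≡_ _≡_ (λ x → proj₁ (spanning x))
        position-inj {x} {y} e = trans (sym (proj₂ (spanning x))) (trans (cong (vs C) e) (proj₂ (spanning y)))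

    minDegreeTwo : MinDegreeTwo G
    minDegreeTwo u with twoNeighbours (spanning u)
    ... | x , y , x≢y , (u~x , _) , (u~y , _) = x , y , x≢y , u~x , u~y

cycleSharp : (k : ℕ) (g z : ℕ) → IsGirth (CycleGraph k) g → IsZeroForcingNumber (CycleGraph k) z →
             z ≡ suc (suc (suc k)) ∸ g + 2
cycleSharp k g z girth@((C , refl) , _) zn@((_ , zf , refl) , _) =
  trans (≤-antisym (≤-trans (zeroForcing≤ N G g z girth zn) (≤-reflexive bound≡2))
                   (2≤zeroForcingSet minDegreeTwo zero (suc zero) (λ ()) zf))
        (sym bound≡2)
  where
    open CycleGraphFacts k
    open Spanning C
    bound≡2 : N ∸ cycleLength C + 2 ≡ 2
    bound≡2 = trans (cong (λ l → N ∸ l + 2) length≡N) (cong (_+ 2) (n∸n≡0 N))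

theorem2 : ((n : ℕ) (G : Graph n) (g z : ℕ) →
               IsGirth G g → IsZeroForcingNumber G z → z ≤ n ∸ g + 2)
             × ((k : ℕ) (g z : ℕ) →
               IsGirth (CycleGraph k) g → IsZeroForcingNumber (CycleGraph k) z →
               z ≡ suc (suc (suc k)) ∸ g + 2)
theorem2 = zeroForcing≤ , cycleSharp
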